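{- Let $P\subset\mathbb{Q}^d$ be a full-dimensional simple rational convex polytope and let $v$ be a vertex of $P$. Let $n_1,\dots,n_d\in(\mathbb{Q}^d)^*$ be the inner normals of the $d$ facets of $P$ containing $v$ (these are linearly independent). For a linear functional $\xi\in(\mathbb{Q}^d)^*$ with $\xi=\sum_{i=1}^d\alpha_i n_i$ and all $\alpha_i\neq 0$, define the polarized tangent cone $$\mathcal{T}^\xi_vP=\{x\in\mathbb{Q}^d:\ n_i(x)\ge n_i(v)\text{ for all } i \text{ with }\alpha_i>0,\ \ n_i(x)<n_i(v)\text{ for all } i \text{ with }\alpha_i<0\},$$ and the index $\operatorname{ind}_\xi(v)=\#\{i:\alpha_i<0\}$. Then: (1) the distinct polarized tangent cones $\mathcal{T}^\xi_vP$, as $\xi$ ranges over all such functionals, form a partition of $\mathbb{Q}^d$; (2) for any two such functionals $\xi_1,\xi_2$, the function $(-1)^{\operatorname{ind}_{\xi_1}(v)}\mathbb{1}_{\mathcal{T}^{\xi_1}_vP}-(-1)^{\operatorname{ind}_{\xi_2}(v)}\mathbb{1}_{\mathcal{T}^{\xi_2}_vP}$ is an integer linear combination of indicator functions of (not necessarily closed) polyhedral cones, each containing an affine line.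
   Context: A polytope is simple if each vertex lies in exactly $d$ facets. For $S\subseteq\mathbb{Q}^d$, $\mathbb{1}_S:\mathbb{Q}^d\to\mathbb{Z}$ is the indicator function of $S$. The condition that all $\alpha_i\ne 0$ is equivalent to $\xi$ not being constant on any edge of $P$ at $v$. A (not necessarily closed) polyhedral cone here means a set defined by finitely many strict or non-strict linear inequalities of the form $\ell(x)\ge \ell(v)$ or $\ell(x)<\ell(v)$ with a common apex. -}

module Defs where

open import Data.Nat using (ℕ; zero; suc)
open import Data.Fin using (Fin; zero; suc)
open import Data.Bool using (Bool; true; false; _∧_; if_then_else_)
open import Data.List using (List; []; _∷_; foldr; map)
open import Data.Product using (_×_; _,_; proj₁; proj₂; ∃; ∃-syntax)
open import Data.Rational using (ℚ; 0ℚ) renaming (_+_ to _+ℚ_; _*_ to _*ℚ_)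
open import Data.Rational.Properties using (_<?_; _≤?_)
open import Data.Integer using (ℤ; +_; -1ℤ) renaming (_+_ to _+ℤ_; _*_ to _*ℤ_; _^_ to _^ℤ_)
open import Relation.Nullary using (does; ¬_)
open import Relation.Binary.PropositionalEquality using (_≡_)

-- Points of ℚ^d and linear functionals in (ℚ^d)^* (identified with ℚ^d via the dot product)
Vecℚ : ℕ → Set
Vecℚ d = Fin d → ℚ

sumFin : ∀ {d} → (Fin d → ℚ) → ℚ
sumFin {zero}  f = 0ℚ
sumFin {suc d} f = f zero +ℚ sumFin (λ i → f (suc i))

ev : ∀ {d} → Vecℚ d → Vecℚ d → ℚ
ev ℓ x = sumFin (λ j → ℓ j *ℚ x j)

_+[_]·_ : ∀ {d} → Vecℚ d → ℚ → Vecℚ d → Vecℚ d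
(p +[ t ]· u) j = p j +ℚ (t *ℚ u j)

lincomb : ∀ {d} → (Fin d → ℚ) → (Fin d → Vecℚ d) → Vecℚ d
lincomb c n j = sumFin (λ i → c i *ℚ n i j)

LinIndep : ∀ {d} → (Fin d → Vecℚ d) → Set
LinIndep {d} n = ∀ (c : Fin d → ℚ) → (∀ j → lincomb c n j ≡ 0ℚ) → ∀ i → c i ≡ 0ℚ

-- A (not necessarily closed) polyhedral cone with apex w: finitely many constraints
-- (ℓ , false) meaning ℓ(x) ≥ ℓ(w), and (ℓ , true) meaning ℓ(x) < ℓ(w).
record Cone (d : ℕ) : Set where
  constructor mkCone
  field
    apex   : Vecℚ d
    ineqs  : List (Vecℚ d × Bool)

satisfies : ∀ {d} → Vecℚ d → Vecℚ d × Bool → Vecℚ d → Bool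
satisfies w (ℓ , false) x = does (ev ℓ w ≤? ev ℓ x)
satisfies w (ℓ , true)  x = does (ev ℓ x <? ev ℓ w)

_∈C_ : ∀ {d} → Vecℚ d → Cone d → Bool
x ∈C mkCone w cs = foldr (λ c b → satisfies w c x ∧ b) true cs

𝟙 : Bool → ℤ
𝟙 true  = + 1
𝟙 false = + 0

ContainsLine : ∀ {d} → Cone d → Set
ContainsLine {d} C =
  ∃[ p ] ∃[ u ] ((∃[ i ] ¬ (u i ≡ 0ℚ)) × (∀ (t : ℚ) → (p +[ t ]· u) ∈C C ≡ true))

-- ξ = Σ α_i n_i is admissible iff all α_i ≠ 0
Admissible : ∀ {d} → (Fin d → ℚ) → Set
Admissible α = ∀ i → ¬ (α i ≡ 0ℚ)

listFin : ∀ d → List (Fin d)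
listFin zero    = []
listFin (suc d) = zero ∷ map suc (listFin d)

polCone : ∀ {d} → (Fin d → Vecℚ d) → Vecℚ d → (Fin d → ℚ) → Cone d
polCone {d} n v α = mkCone v (map (λ i → (n i , does (α i <? 0ℚ))) (listFin d))

ind : ∀ {d} → (Fin d → ℚ) → ℕ
ind {d} α = foldr (λ i k → if does (α i <? 0ℚ) then suc k else k) zero (listFin d)

sgn : ℕ → ℤ
sgn k = -1ℤ ^ℤ k

combo : ∀ {d} → List (ℤ × Cone d) → Vecℚ d → ℤ
combo L x = foldr (λ cC s → (proj₁ cC *ℤ 𝟙 (x ∈C proj₂ cC)) +ℤ s) (+ 0) L

{-# OPTIONS --safe #-}
-- Write σ(b) = -1 for a strict flag b and σ(b) = 1 otherwise. For one facet normal ℓ,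
-- σ(b)·𝟙[x satisfies (ℓ , b)] = 𝟙[ℓ(x) ≥ ℓ(v)] - 𝟙 b, so changing the flag of a single facet
-- changes the signed indicator by a constant times the indicator of the cone with that facet
-- dropped. Flipping the flags of α into those of β one facet at a time therefore writes the
-- difference in (2) as a ℤ-combination of cones, each missing one facet constraint. Such a cone
-- contains the line through any of its points in the direction of a nonzero u killed by the
-- remaining d - 1 normals, and it has points because, the normals being independent,
-- x ↦ (nᵢ(x))ᵢ is onto ℚ^d. For (1), x lies in the cone whose flags record which of the strict
-- inequalities nᵢ(x) < nᵢ(v) hold, and any cone containing x must carry exactly these flags.
module Submission where

open import Defs
open import Data.Nat using (ℕ; zero; suc; _<_; s≤s)
open import Data.Nat.Properties using (n<1+n)
open import Data.Fin using (Fin; zero; suc; punchIn; punchOut) renaming (_≟_ to _≟ᶠ_)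
open import Data.Fin.Properties using (suc-injective; punchIn-punchOut; all?; ¬∀⟶∃¬)
open import Data.Vec.Functional using (tail) renaming (_∷_ to _∷ᵥ_)
open import Data.Bool using (Bool; true; false; _∧_; not; _xor_; if_then_else_)
open import Data.Bool.Properties using (xor-inverseˡ)
open import Data.Maybe using (Maybe; just; nothing)
open import Data.List using (List; []; _∷_; foldr; map)
open import Data.List.Properties using (map-∘; map-cong; foldr-map)
open import Data.List.Relation.Unary.All as All using (All; []; _∷_)
open import Data.List.Relation.Unary.All.Properties using (map⁺; map⁻)
open import Data.Product using (_×_; _,_; proj₁; proj₂; ∃; ∃-syntax; map₂)
open import Data.Rational using (ℚ; 0ℚ; 1ℚ; 1/_; NonZero; ≢-nonZero)
  renaming (_+_ to _+ℚ_; _*_ to _*ℚ_; -_ to -ℚ_; _-_ to _-ℚ_; _<_ to _<ℚ_; _≤_ to _≤ℚ_)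
open import Data.Rational.Properties as ℚ using (_≟_; _≤?_; _<?_; +-*-commutativeRing)
open import Data.Integer using (ℤ; +_; -1ℤ; _+_; _-_; _*_)
open import Data.Integer.Properties as ℤ using ()
open import Data.Integer.Tactic.RingSolver using () renaming (ring to ℤ-ring)
open import Data.Empty using (⊥-elim)
open import Function using (_∘_; mk⇔)
open import Level using (0ℓ)
open import Relation.Nullary using (¬_; yes; no; does; ¬?)
open import Relation.Nullary.Decidable using (dec-true; does-⇔; dec⇒maybe)
open import Relation.Binary.PropositionalEquality
open import Tactic.RingSolver using (solve-∀)
open import Tactic.RingSolver.Core.AlmostCommutativeRing
  using (AlmostCommutativeRing; fromCommutativeRing)

ℚ-ring : AlmostCommutativeRing 0ℓ 0ℓ
ℚ-ring = fromCommutativeRing +-*-commutativeRing (λ q → dec⇒maybe (0ℚ ≟ q))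

0ᵥ : ∀ {d} → Vecℚ d
0ᵥ _ = 0ℚ

ev-comm : ∀ {d} (ℓ x : Vecℚ d) → ev ℓ x ≡ ev x ℓ
ev-comm {zero}  ℓ x = refl
ev-comm {suc d} ℓ x = cong₂ _+ℚ_ (ℚ.*-comm (ℓ zero) (x zero)) (ev-comm (tail ℓ) (tail x))

ev-vanishingˡ : ∀ {d} {ℓ : Vecℚ d} (x : Vecℚ d) → (∀ j → ℓ j ≡ 0ℚ) → ev ℓ x ≡ 0ℚ
ev-vanishingˡ {zero}  x ℓ≡0 = refl
ev-vanishingˡ {suc d} {ℓ} x ℓ≡0 = begin
  ℓ zero *ℚ x zero +ℚ ev (tail ℓ) (tail x)  ≡⟨ cong₂ (λ a s → a *ℚ x zero +ℚ s) (ℓ≡0 zero) (ev-vanishingˡ (tail x) (ℓ≡0 ∘ suc)) ⟩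
  0ℚ *ℚ x zero +ℚ 0ℚ                        ≡⟨ cong (_+ℚ 0ℚ) (ℚ.*-zeroˡ (x zero)) ⟩
  0ℚ                                        ∎
  where open ≡-Reasoning

ev-0ᵥ : ∀ {d} (x : Vecℚ d) → ev 0ᵥ x ≡ 0ℚ
ev-0ᵥ x = ev-vanishingˡ x (λ _ → refl)

ev-vanishingʳ : ∀ {d} (ℓ : Vecℚ d) {x : Vecℚ d} → (∀ j → x j ≡ 0ℚ) → ev ℓ x ≡ 0ℚ
ev-vanishingʳ ℓ x≡0 = trans (ev-comm ℓ _) (ev-vanishingˡ ℓ x≡0)

ev-+ˡ : ∀ {d} (ℓ ℓ′ x : Vecℚ d) → ev (λ j → ℓ j +ℚ ℓ′ j) x ≡ ev ℓ x +ℚ ev ℓ′ x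
ev-+ˡ {zero}  ℓ ℓ′ x = refl
ev-+ˡ {suc d} ℓ ℓ′ x =
  trans (cong ((ℓ zero +ℚ ℓ′ zero) *ℚ x zero +ℚ_) (ev-+ˡ (tail ℓ) (tail ℓ′) (tail x)))
        (regroup (ℓ zero) (ℓ′ zero) (x zero) (ev (tail ℓ) (tail x)) (ev (tail ℓ′) (tail x)))
  where
  regroup : ∀ a b y s t → (a +ℚ b) *ℚ y +ℚ (s +ℚ t) ≡ (a *ℚ y +ℚ s) +ℚ (b *ℚ y +ℚ t)
  regroup = solve-∀ ℚ-ring

ev-*ˡ : ∀ {d} c (ℓ x : Vecℚ d) → ev (λ j → c *ℚ ℓ j) x ≡ c *ℚ ev ℓ x
ev-*ˡ {zero}  c ℓ x = sym (ℚ.*-zeroʳ c)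
ev-*ˡ {suc d} c ℓ x =
  trans (cong₂ _+ℚ_ (ℚ.*-assoc c (ℓ zero) (x zero)) (ev-*ˡ c (tail ℓ) (tail x)))
        (sym (ℚ.*-distribˡ-+ c _ _))

ev-linearˡ : ∀ {d} a b (ℓ ℓ′ x : Vecℚ d) →
  ev (λ j → a *ℚ ℓ j +ℚ b *ℚ ℓ′ j) x ≡ a *ℚ ev ℓ x +ℚ b *ℚ ev ℓ′ x
ev-linearˡ a b ℓ ℓ′ x =
  trans (ev-+ˡ (λ j → a *ℚ ℓ j) (λ j → b *ℚ ℓ′ j) x) (cong₂ _+ℚ_ (ev-*ˡ a ℓ x) (ev-*ˡ b ℓ′ x))

ev-*ʳ : ∀ {d} c (ℓ x : Vecℚ d) → ev ℓ (λ j → c *ℚ x j) ≡ c *ℚ ev ℓ x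
ev-*ʳ c ℓ x = begin
  ev ℓ (λ j → c *ℚ x j)  ≡⟨ ev-comm ℓ _ ⟩
  ev (λ j → c *ℚ x j) ℓ  ≡⟨ ev-*ˡ c x ℓ ⟩
  c *ℚ ev x ℓ            ≡⟨ cong (c *ℚ_) (ev-comm x ℓ) ⟩
  c *ℚ ev ℓ x            ∎
  where open ≡-Reasoning

ev-line : ∀ {d} (ℓ p u : Vecℚ d) t → ev ℓ (p +[ t ]· u) ≡ ev ℓ p +ℚ t *ℚ ev ℓ u
ev-line ℓ p u t = begin
  ev ℓ (p +[ t ]· u)               ≡⟨ ev-comm ℓ _ ⟩
  ev (p +[ t ]· u) ℓ               ≡⟨ ev-+ˡ p _ ℓ ⟩
  ev p ℓ +ℚ ev (λ j → t *ℚ u j) ℓ  ≡⟨ cong (ev p ℓ +ℚ_) (ev-*ˡ t u ℓ) ⟩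
  ev p ℓ +ℚ t *ℚ ev u ℓ            ≡⟨ cong₂ (λ a b → a +ℚ t *ℚ b) (ev-comm p ℓ) (ev-comm u ℓ) ⟩
  ev ℓ p +ℚ t *ℚ ev ℓ u            ∎
  where open ≡-Reasoning

ev-lincomb : ∀ {m d} (c : Fin m → ℚ) (n : Fin m → Vecℚ d) x →
  ev (λ j → sumFin (λ i → c i *ℚ n i j)) x ≡ sumFin (λ i → c i *ℚ ev (n i) x)
ev-lincomb {zero}  c n x = ev-0ᵥ x
ev-lincomb {suc m} c n x = begin
  ev (λ j → c zero *ℚ n zero j +ℚ sumFin (λ i → c (suc i) *ℚ n (suc i) j)) x
    ≡⟨ ev-+ˡ (λ j → c zero *ℚ n zero j) (λ j → sumFin (λ i → c (suc i) *ℚ n (suc i) j)) x ⟩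
  ev (λ j → c zero *ℚ n zero j) x +ℚ ev (λ j → sumFin (λ i → c (suc i) *ℚ n (suc i) j)) x
    ≡⟨ cong₂ _+ℚ_ (ev-*ˡ (c zero) (n zero) x) (ev-lincomb (c ∘ suc) (n ∘ suc) x) ⟩
  c zero *ℚ ev (n zero) x +ℚ sumFin (λ i → c (suc i) *ℚ ev (n (suc i)) x)
    ∎
  where open ≡-Reasoning

ev-supported : ∀ {d} (ℓ x : Vecℚ d) k → (∀ j → k ≢ j → ℓ j ≡ 0ℚ) → ev ℓ x ≡ ℓ k *ℚ x k
ev-supported ℓ x zero ℓ≡0 = begin
  ℓ zero *ℚ x zero +ℚ ev (tail ℓ) (tail x)  ≡⟨ cong (ℓ zero *ℚ x zero +ℚ_) (ev-vanishingˡ (tail x) (λ j → ℓ≡0 (suc j) λ ())) ⟩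
  ℓ zero *ℚ x zero +ℚ 0ℚ                    ≡⟨ ℚ.+-identityʳ _ ⟩
  ℓ zero *ℚ x zero                          ∎
  where open ≡-Reasoning
ev-supported ℓ x (suc k) ℓ≡0 = begin
  ℓ zero *ℚ x zero +ℚ ev (tail ℓ) (tail x)  ≡⟨ cong₂ (λ a s → a *ℚ x zero +ℚ s) (ℓ≡0 zero λ ()) (ev-supported (tail ℓ) (tail x) k (λ j k≢j → ℓ≡0 (suc j) (k≢j ∘ suc-injective))) ⟩
  0ℚ *ℚ x zero +ℚ ℓ (suc k) *ℚ x (suc k)    ≡⟨ cong (_+ℚ ℓ (suc k) *ℚ x (suc k)) (ℚ.*-zeroˡ (x zero)) ⟩
  0ℚ +ℚ ℓ (suc k) *ℚ x (suc k)              ≡⟨ ℚ.+-identityˡ _ ⟩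
  ℓ (suc k) *ℚ x (suc k)                    ∎
  where open ≡-Reasoning

NonZeroVec : ∀ {d} → Vecℚ d → Set
NonZeroVec u = ∃[ i ] ¬ u i ≡ 0ℚ

m*n≡0⇒m≡0 : ∀ {m n} → ¬ n ≡ 0ℚ → m *ℚ n ≡ 0ℚ → m ≡ 0ℚ
m*n≡0⇒m≡0 {m} {n} n≢0 mn≡0 = begin
  m                      ≡⟨ ℚ.*-identityʳ m ⟨
  m *ℚ 1ℚ                ≡⟨ cong (m *ℚ_) (ℚ.*-inverseʳ n) ⟨
  m *ℚ (n *ℚ 1/ n)       ≡⟨ ℚ.*-assoc m n (1/ n) ⟨
  m *ℚ n *ℚ 1/ n         ≡⟨ cong (_*ℚ 1/ n) mn≡0 ⟩
  0ℚ *ℚ 1/ n             ≡⟨ ℚ.*-zeroˡ (1/ n) ⟩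
  0ℚ                     ∎
  where
  open ≡-Reasoning
  instance
    n≢0′ : NonZero n
    n≢0′ = ≢-nonZero n≢0

e₀ : ∀ {d} → Vecℚ (suc d)
e₀ = 1ℚ ∷ᵥ 0ᵥ

ev-e₀ : ∀ {d} (ℓ : Vecℚ (suc d)) → ev ℓ e₀ ≡ ℓ zero
ev-e₀ ℓ = begin
  ℓ zero *ℚ 1ℚ +ℚ ev (tail ℓ) 0ᵥ         ≡⟨ cong (ℓ zero *ℚ 1ℚ +ℚ_) (ev-vanishingʳ (tail ℓ) (λ _ → refl)) ⟩
  ℓ zero *ℚ 1ℚ +ℚ 0ℚ                       ≡⟨ ℚ.+-identityʳ _ ⟩
  ℓ zero *ℚ 1ℚ                             ≡⟨ ℚ.*-identityʳ (ℓ zero) ⟩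
  ℓ zero                                   ∎
  where open ≡-Reasoning

∀punchIn⇒∀≢ : ∀ {m} {P : Fin (suc m) → Set} k → (∀ l → P (punchIn k l)) → ∀ j → k ≢ j → P j
∀punchIn⇒∀≢ {P = P} k h j k≢j = subst P (punchIn-punchOut k≢j) (h (punchOut k≢j))

pivotReduce : ∀ {m d} → (Fin m → Vecℚ (suc d)) → Fin m → Fin m → Vecℚ d
pivotReduce f r r′ j = f r zero *ℚ f r′ (suc j) +ℚ (-ℚ f r′ zero) *ℚ f r (suc j)

pivotLift : ∀ {m d} → (Fin m → Vecℚ (suc d)) → Fin m → Vecℚ d → Vecℚ (suc d)
pivotLift f r w = (-ℚ ev (tail (f r)) w) ∷ᵥ λ j → f r zero *ℚ w j

ev-pivotLift : ∀ {m d} (f : Fin m → Vecℚ (suc d)) r r′ w →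
  ev (f r′) (pivotLift f r w) ≡ ev (pivotReduce f r r′) w
ev-pivotLift f r r′ w = begin
  f r′ zero *ℚ (-ℚ E) +ℚ ev (tail (f r′)) (λ j → a *ℚ w j)  ≡⟨ cong (f r′ zero *ℚ (-ℚ E) +ℚ_) (ev-*ʳ a (tail (f r′)) w) ⟩
  f r′ zero *ℚ (-ℚ E) +ℚ a *ℚ ev (tail (f r′)) w           ≡⟨ rearrange (f r′ zero) E a _ ⟩
  a *ℚ ev (tail (f r′)) w +ℚ (-ℚ f r′ zero) *ℚ E           ≡⟨ ev-linearˡ a (-ℚ f r′ zero) (tail (f r′)) (tail (f r)) w ⟨
  ev (pivotReduce f r r′) w                                ∎
  where
  open ≡-Reasoning
  a E : ℚ
  a = f r zero
  E = ev (tail (f r)) w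
  rearrange : ∀ b e a g → b *ℚ (-ℚ e) +ℚ a *ℚ g ≡ a *ℚ g +ℚ (-ℚ b) *ℚ e
  rearrange = solve-∀ ℚ-ring

pivotReduce-self : ∀ {m d} (f : Fin m → Vecℚ (suc d)) r w → ev (pivotReduce f r r) w ≡ 0ℚ
pivotReduce-self f r w = begin
  ev (pivotReduce f r r) w  ≡⟨ ev-linearˡ a (-ℚ a) (tail (f r)) (tail (f r)) w ⟩
  a *ℚ E +ℚ (-ℚ a) *ℚ E     ≡⟨ ℚ.*-distribʳ-+ E a (-ℚ a) ⟨
  (a +ℚ (-ℚ a)) *ℚ E        ≡⟨ cong (_*ℚ E) (ℚ.+-inverseʳ a) ⟩
  0ℚ *ℚ E                   ≡⟨ ℚ.*-zeroˡ E ⟩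
  0ℚ                        ∎
  where
  open ≡-Reasoning
  a E : ℚ
  a = f r zero
  E = ev (tail (f r)) w

common-zero : ∀ {m d} → m < d → (f : Fin m → Vecℚ d) →
  ∃[ u ] (NonZeroVec u × ∀ r → ev (f r) u ≡ 0ℚ)
common-zero {zero}  {suc d} _ f = e₀ , (zero , λ ()) , λ ()
common-zero {suc m} {suc d} (s≤s m<d) f with all? (λ r → f r zero ≟ 0ℚ)
... | yes firstColumn≡0 = e₀ , (zero , λ ()) , λ r → trans (ev-e₀ (f r)) (firstColumn≡0 r)
... | no  firstColumn≢0 with ¬∀⟶∃¬ _ _ (λ r → f r zero ≟ 0ℚ) firstColumn≢0
...   | r , pivot≢0 with common-zero m<d (pivotReduce f r ∘ punchIn r)
...     | w , (i , wᵢ≢0) , reduced≡0 =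
  pivotLift f r w , (suc i , wᵢ≢0 ∘ m*n≡0⇒m≡0 pivot≢0 ∘ trans (ℚ.*-comm (w i) (f r zero))) , λ r′ →
    trans (ev-pivotLift f r r′ w) (reduced-vanishes r′)
  where
  reduced-vanishes : ∀ r′ → ev (pivotReduce f r r′) w ≡ 0ℚ
  reduced-vanishes r′ with r ≟ᶠ r′
  ... | yes refl = pivotReduce-self f r w
  ... | no  r≢r′ = ∀punchIn⇒∀≢ r reduced≡0 r′ r≢r′

common-zero-except : ∀ {d} (f : Fin d → Vecℚ d) k →
  ∃[ u ] (NonZeroVec u × ∀ j → k ≢ j → ev (f j) u ≡ 0ℚ)
common-zero-except {suc d} f k with common-zero (n<1+n d) (f ∘ punchIn k)
... | u , u≢0 , fu≡0 = u , u≢0 , ∀punchIn⇒∀≢ k fu≡0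

-- Choose c ≠ 0 such that φ = Σ cᵢ nᵢ vanishes off column k; then φₖ uₖ = φ(u) = Σ cᵢ nᵢ(u) = 0,
-- so φ = 0 as well, against independence.
linIndep⇒trivialKernel : ∀ {d} {n : Fin d → Vecℚ d} {u} → LinIndep n →
  (∀ j → ev (n j) u ≡ 0ℚ) → ¬ NonZeroVec u
linIndep⇒trivialKernel {suc d} {n} {u} indep nu≡0 (k , uₖ≢0)
  with common-zero-except (λ col i → n i col) k
... | c , (i , cᵢ≢0) , columns≡0 = cᵢ≢0 (indep c lincomb≡0 i)
  where
  φ : Vecℚ (suc d)
  φ = lincomb c n
  φ-off-k : ∀ col → k ≢ col → φ col ≡ 0ℚ
  φ-off-k col k≢col = trans (ev-comm c (λ i → n i col)) (columns≡0 col k≢col)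
  φₖuₖ≡0 : φ k *ℚ u k ≡ 0ℚ
  φₖuₖ≡0 = begin
    φ k *ℚ u k                  ≡⟨ ev-supported φ u k φ-off-k ⟨
    ev φ u                      ≡⟨ ev-lincomb c n u ⟩
    ev c (λ i → ev (n i) u)     ≡⟨ ev-vanishingʳ c nu≡0 ⟩
    0ℚ                          ∎
    where open ≡-Reasoning
  lincomb≡0 : ∀ col → φ col ≡ 0ℚ
  lincomb≡0 col with k ≟ᶠ col
  ... | yes refl  = m*n≡0⇒m≡0 uₖ≢0 φₖuₖ≡0
  ... | no  k≢col = φ-off-k col k≢col

dehomogenise : ∀ {d} {n : Fin d → Vecℚ d} → LinIndep n → (b : Fin d → ℚ) (w : Vecℚ (suc d)) →
  NonZeroVec w → (∀ j → ev (n j) (tail w) ≡ b j *ℚ w zero) → ∃[ x ] (∀ j → ev (n j) x ≡ b j)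
dehomogenise {n = n} indep b w (i , wᵢ≢0) ntail≡bw₀ with w zero ≟ 0ℚ
... | yes w₀≡0 = ⊥-elim (linIndep⇒trivialKernel indep ntail≡0 (tail-nonzero i wᵢ≢0))
  where
  ntail≡0 : ∀ j → ev (n j) (tail w) ≡ 0ℚ
  ntail≡0 j = trans (ntail≡bw₀ j) (trans (cong (b j *ℚ_) w₀≡0) (ℚ.*-zeroʳ (b j)))
  tail-nonzero : ∀ i → ¬ w i ≡ 0ℚ → NonZeroVec (tail w)
  tail-nonzero zero    w₀≢0 = ⊥-elim (w₀≢0 w₀≡0)
  tail-nonzero (suc k) wₖ≢0 = k , wₖ≢0
... | no w₀≢0 = (λ k → 1/ w zero *ℚ w (suc k)) , λ j → begin
  ev (n j) (λ k → 1/ w zero *ℚ w (suc k))  ≡⟨ ev-*ʳ (1/ w zero) (n j) (tail w) ⟩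
  1/ w zero *ℚ ev (n j) (tail w)           ≡⟨ cong (1/ w zero *ℚ_) (ntail≡bw₀ j) ⟩
  1/ w zero *ℚ (b j *ℚ w zero)             ≡⟨ ℚ.*-comm (1/ w zero) _ ⟩
  b j *ℚ w zero *ℚ 1/ w zero               ≡⟨ ℚ.*-assoc (b j) (w zero) (1/ w zero) ⟩
  b j *ℚ (w zero *ℚ 1/ w zero)             ≡⟨ cong (b j *ℚ_) (ℚ.*-inverseʳ (w zero)) ⟩
  b j *ℚ 1ℚ                                ≡⟨ ℚ.*-identityʳ (b j) ⟩
  b j                                      ∎
  where
  open ≡-Reasoning
  instance
    w₀≢0′ : NonZero (w zero)
    w₀≢0′ = ≢-nonZero w₀≢0

linIndep⇒surjective : ∀ {d} {n : Fin d → Vecℚ d} → LinIndep n →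
  (b : Fin d → ℚ) → ∃[ x ] (∀ j → ev (n j) x ≡ b j)
linIndep⇒surjective {d} {n} indep b with common-zero (n<1+n d) (λ j → (-ℚ b j) ∷ᵥ n j)
... | w , w≢0 , augmented≡0 = dehomogenise indep b w w≢0 λ j → begin
  ev (n j) (tail w)                                  ≡⟨ solve-for (b j) (w zero) (ev (n j) (tail w)) ⟩
  (-ℚ b j) *ℚ w zero +ℚ ev (n j) (tail w) +ℚ b j *ℚ w zero  ≡⟨ cong (_+ℚ b j *ℚ w zero) (augmented≡0 j) ⟩
  0ℚ +ℚ b j *ℚ w zero                                ≡⟨ ℚ.+-identityˡ _ ⟩
  b j *ℚ w zero                                      ∎
  where
  open ≡-Reasoning
  solve-for : ∀ β ω y → y ≡ (-ℚ β) *ℚ ω +ℚ y +ℚ β *ℚ ω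
  solve-for = solve-∀ ℚ-ring

satisfies-strict : ∀ {d} (w ℓ x : Vecℚ d) → satisfies w (ℓ , true) x ≡ not (satisfies w (ℓ , false) x)
satisfies-strict w ℓ x = does-⇔ (mk⇔ <⇒≱ ℚ.≰⇒>) (ev ℓ x <? ev ℓ w) (¬? (ev ℓ w ≤? ev ℓ x))
  where
  <⇒≱ : ev ℓ x <ℚ ev ℓ w → ¬ ev ℓ w ≤ℚ ev ℓ x
  <⇒≱ ℓx<ℓw ℓw≤ℓx = ℚ.<-irrefl refl (ℚ.<-≤-trans ℓx<ℓw ℓw≤ℓx)

satisfies-xor : ∀ {d} (w ℓ x : Vecℚ d) b → satisfies w (ℓ , b) x ≡ b xor satisfies w (ℓ , false) x
satisfies-xor w ℓ x true  = satisfies-strict w ℓ x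
satisfies-xor w ℓ x false = refl

satisfies-ownFlag : ∀ {d} (w ℓ x : Vecℚ d) → satisfies w (ℓ , satisfies w (ℓ , true) x) x ≡ true
satisfies-ownFlag w ℓ x = begin
  satisfies w (ℓ , satisfies w (ℓ , true) x) x  ≡⟨ satisfies-xor w ℓ x (satisfies w (ℓ , true) x) ⟩
  satisfies w (ℓ , true) x xor a                ≡⟨ cong (_xor a) (satisfies-strict w ℓ x) ⟩
  not a xor a                                   ≡⟨ xor-inverseˡ a ⟩
  true                                          ∎
  where
  open ≡-Reasoning
  a : Bool
  a = satisfies w (ℓ , false) x

satisfies⇒flag : ∀ {d} (w ℓ x : Vecℚ d) b → satisfies w (ℓ , b) x ≡ true → b ≡ satisfies w (ℓ , true) x
satisfies⇒flag w ℓ x true  sat = sym sat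
satisfies⇒flag w ℓ x false sat = sym (trans (satisfies-strict w ℓ x) (cong not sat))

satisfies-cong : ∀ {d} {w ℓ x y : Vecℚ d} b → ev ℓ x ≡ ev ℓ y → satisfies w (ℓ , b) x ≡ satisfies w (ℓ , b) y
satisfies-cong {w = w} {ℓ} false ℓx≡ℓy = cong (λ q → does (ev ℓ w ≤? q)) ℓx≡ℓy
satisfies-cong {w = w} {ℓ} true  ℓx≡ℓy = cong (λ q → does (q <? ev ℓ w)) ℓx≡ℓy

∈C-All⁺ : ∀ {d} {w x : Vecℚ d} cs → All (λ c → satisfies w c x ≡ true) cs → x ∈C mkCone w cs ≡ true
∈C-All⁺ []       []           = refl
∈C-All⁺ (c ∷ cs) (sat ∷ sats) = cong₂ _∧_ sat (∈C-All⁺ cs sats)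

∈C-All⁻ : ∀ {d} {w x : Vecℚ d} cs → x ∈C mkCone w cs ≡ true → All (λ c → satisfies w c x ≡ true) cs
∈C-All⁻ []                 _ = []
∈C-All⁻ {w = w} {x} (c ∷ cs) x∈C with satisfies w c x in sat
... | true = sat ∷ ∈C-All⁻ cs x∈C

∈C-translate : ∀ {d} {w x u : Vecℚ d} t cs → All (λ c → ev (proj₁ c) u ≡ 0ℚ) cs →
  (x +[ t ]· u) ∈C mkCone w cs ≡ x ∈C mkCone w cs
∈C-translate t [] [] = refl
∈C-translate {x = x} {u} t ((ℓ , b) ∷ cs) (ℓu≡0 ∷ rest) =
  cong₂ _∧_ (satisfies-cong b ℓ[x+tu]≡ℓx) (∈C-translate t cs rest)
  where
  ℓ[x+tu]≡ℓx : ev ℓ (x +[ t ]· u) ≡ ev ℓ x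
  ℓ[x+tu]≡ℓx = begin
    ev ℓ (x +[ t ]· u)      ≡⟨ ev-line ℓ x u t ⟩
    ev ℓ x +ℚ t *ℚ ev ℓ u   ≡⟨ cong (λ q → ev ℓ x +ℚ t *ℚ q) ℓu≡0 ⟩
    ev ℓ x +ℚ t *ℚ 0ℚ       ≡⟨ cong (ev ℓ x +ℚ_) (ℚ.*-zeroʳ t) ⟩
    ev ℓ x +ℚ 0ℚ            ≡⟨ ℚ.+-identityʳ (ev ℓ x) ⟩
    ev ℓ x                  ∎
    where open ≡-Reasoning

containsLine : ∀ {d} {w x u : Vecℚ d} cs → x ∈C mkCone w cs ≡ true → NonZeroVec u →
  All (λ c → ev (proj₁ c) u ≡ 0ℚ) cs → ContainsLine (mkCone w cs)
containsLine {x = x} {u} cs x∈C u≢0 csu≡0 = x , u , u≢0 , λ t → trans (∈C-translate t cs csu≡0) x∈C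

All-listFin⁺ : ∀ {m} {P : Fin m → Set} → (∀ j → P j) → All P (listFin m)
All-listFin⁺ {zero}  h = []
All-listFin⁺ {suc m} h = h zero ∷ map⁺ (All-listFin⁺ (h ∘ suc))

All-listFin⁻ : ∀ {m} {P : Fin m → Set} → All P (listFin m) → ∀ j → P j
All-listFin⁻ (p ∷ ps) zero    = p
All-listFin⁻ (p ∷ ps) (suc j) = All-listFin⁻ (map⁻ ps) j

-- A dropped facet (nothing) becomes the constraint 0(x) ≥ 0(v), which every point satisfies.
constraint : ∀ {d} → Vecℚ d → Maybe Bool → Vecℚ d × Bool
constraint ℓ (just b) = ℓ , b
constraint ℓ nothing  = 0ᵥ , false

facetCone : ∀ {m d} → (Fin m → Vecℚ d) → Vecℚ d → (Fin m → Maybe Bool) → Cone d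
facetCone {m} n v c = mkCone v (map (λ j → constraint (n j) (c j)) (listFin m))

facetCone-∈⁺ : ∀ {m d} {n : Fin m → Vecℚ d} {v x c} →
  (∀ j → satisfies v (constraint (n j) (c j)) x ≡ true) → x ∈C facetCone n v c ≡ true
facetCone-∈⁺ sat = ∈C-All⁺ _ (map⁺ (All-listFin⁺ sat))

facetCone-∈⁻ : ∀ {m d} {n : Fin m → Vecℚ d} {v x c} →
  x ∈C facetCone n v c ≡ true → ∀ j → satisfies v (constraint (n j) (c j)) x ≡ true
facetCone-∈⁻ x∈C = All-listFin⁻ (map⁻ (∈C-All⁻ _ x∈C))

facetCone-∈-suc : ∀ {m d} (n : Fin (suc m) → Vecℚ d) v c x →
  x ∈C facetCone n v c ≡ satisfies v (constraint (n zero) (c zero)) x ∧ x ∈C facetCone (n ∘ suc) v (c ∘ suc)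
facetCone-∈-suc {m} n v c x =
  cong (λ cs → satisfies v (constraint (n zero) (c zero)) x ∧ x ∈C mkCone v cs) (sym (map-∘ (listFin m)))

trivial-satisfied : ∀ {d} (w x : Vecℚ d) → satisfies w (0ᵥ , false) x ≡ true
trivial-satisfied w x = dec-true (ev 0ᵥ w ≤? ev 0ᵥ x) (ℚ.≤-reflexive (trans (ev-0ᵥ w) (sym (ev-0ᵥ x))))

p-1<p : ∀ p → p -ℚ 1ℚ <ℚ p
p-1<p p = subst (p -ℚ 1ℚ <ℚ_) (ℚ.+-identityʳ p) (ℚ.+-monoʳ-< p (ℚ.negative⁻¹ (-ℚ 1ℚ)))

target : ∀ {d} → Vecℚ d → Vecℚ d → Maybe Bool → ℚ
target w ℓ (just true) = ev ℓ w -ℚ 1ℚ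
target w ℓ _           = ev ℓ w

satisfies-target : ∀ {d} (w ℓ x : Vecℚ d) c → ev ℓ x ≡ target w ℓ c → satisfies w (constraint ℓ c) x ≡ true
satisfies-target w ℓ x (just true) ℓx≡ℓw-1 =
  dec-true (ev ℓ x <? ev ℓ w) (subst (_<ℚ ev ℓ w) (sym ℓx≡ℓw-1) (p-1<p (ev ℓ w)))
satisfies-target w ℓ x (just false) ℓx≡ℓw = dec-true (ev ℓ w ≤? ev ℓ x) (ℚ.≤-reflexive (sym ℓx≡ℓw))
satisfies-target w ℓ x nothing _ = trivial-satisfied w x

facetCone-nonempty : ∀ {d} {n : Fin d → Vecℚ d} → LinIndep n → ∀ v c → ∃[ x ] (x ∈C facetCone n v c ≡ true)
facetCone-nonempty {n = n} indep v c with linIndep⇒surjective indep (λ j → target v (n j) (c j))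
... | x , nx≡target = x , facetCone-∈⁺ (λ j → satisfies-target v (n j) x (c j) (nx≡target j))

constraint-vanishes : ∀ {d} (ℓ u : Vecℚ d) c → ev ℓ u ≡ 0ℚ → ev (proj₁ (constraint ℓ c)) u ≡ 0ℚ
constraint-vanishes ℓ u (just _) ℓu≡0 = ℓu≡0
constraint-vanishes ℓ u nothing  _    = ev-0ᵥ u

facetCone-lineality : ∀ {m d} (n : Fin m → Vecℚ d) v c {i u} → c i ≡ nothing →
  (∀ j → i ≢ j → ev (n j) u ≡ 0ℚ) → All (λ cs → ev (proj₁ cs) u ≡ 0ℚ) (Cone.ineqs (facetCone n v c))
facetCone-lineality n v c {i} {u} cᵢ≡nothing nu≡0 = map⁺ (All-listFin⁺ vanishes)
  where
  vanishes : ∀ j → ev (proj₁ (constraint (n j) (c j))) u ≡ 0ℚ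
  vanishes j with i ≟ᶠ j
  ... | yes refl = subst (λ cᵢ → ev (proj₁ (constraint (n i) cᵢ)) u ≡ 0ℚ) (sym cᵢ≡nothing) (ev-0ᵥ u)
  ... | no  i≢j  = constraint-vanishes (n j) u (c j) (nu≡0 j i≢j)

facetCone-containsLine : ∀ {d} {n : Fin d → Vecℚ d} → LinIndep n → ∀ v c →
  (∃[ i ] c i ≡ nothing) → ContainsLine (facetCone n v c)
facetCone-containsLine {n = n} indep v c (i , cᵢ≡nothing) with common-zero-except n i
... | u , u≢0 , nu≡0 =
  containsLine _ (proj₂ (facetCone-nonempty indep v c)) u≢0 (facetCone-lineality n v c cᵢ≡nothing nu≡0)

DropsFacet : ∀ {m} → ℤ × (Fin m → Maybe Bool) → Set
DropsFacet (_ , c) = ∃[ i ] c i ≡ nothing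

facetCombo : ∀ {m d} → (Fin m → Vecℚ d) → Vecℚ d → List (ℤ × (Fin m → Maybe Bool)) → List (ℤ × Cone d)
facetCombo n v = map (map₂ (facetCone n v))

facetCombo-containsLines : ∀ {d} {n : Fin d → Vecℚ d} → LinIndep n → ∀ v (L : List (ℤ × (Fin d → Maybe Bool))) →
  All DropsFacet L → All (λ zC → ContainsLine (proj₂ zC)) (facetCombo n v L)
facetCombo-containsLines indep v L dropped = map⁺ (All.map (facetCone-containsLine indep v _) dropped)

flagSign : Bool → ℤ
flagSign true  = -1ℤ
flagSign false = + 1

count : ∀ {m} → (Fin m → Bool) → ℕ
count {m} s = foldr (λ i k → if s i then suc k else k) zero (listFin m)

sgn-count-suc : ∀ {m} (s : Fin (suc m) → Bool) → sgn (count s) ≡ flagSign (s zero) * sgn (count (s ∘ suc))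
sgn-count-suc {m} s with s zero
... | true  = cong (λ k → -1ℤ * sgn k) (foldr-map _ suc zero (listFin m))
... | false = trans (cong sgn (foldr-map _ suc zero (listFin m))) (sym (ℤ.*-identityˡ _))

𝟙-∧ : ∀ a b → 𝟙 (a ∧ b) ≡ 𝟙 a * 𝟙 b
𝟙-∧ true  true  = refl
𝟙-∧ true  false = refl
𝟙-∧ false _     = refl

signed-𝟙-xor : ∀ a b → flagSign b * 𝟙 (b xor a) ≡ 𝟙 a - 𝟙 b
signed-𝟙-xor true  true  = refl
signed-𝟙-xor false true  = refl
signed-𝟙-xor true  false = refl
signed-𝟙-xor false false = refl

signed-difference : ∀ {d} (w ℓ x : Vecℚ d) b b′ →
  flagSign b * 𝟙 (satisfies w (ℓ , b) x) - flagSign b′ * 𝟙 (satisfies w (ℓ , b′) x) ≡ 𝟙 b′ - 𝟙 b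
signed-difference w ℓ x b b′ = begin
  flagSign b * 𝟙 (satisfies w (ℓ , b) x) - flagSign b′ * 𝟙 (satisfies w (ℓ , b′) x)
    ≡⟨ cong₂ _-_ (signed b) (signed b′) ⟩
  (𝟙 a - 𝟙 b) - (𝟙 a - 𝟙 b′)
    ≡⟨ cancel (𝟙 a) (𝟙 b) (𝟙 b′) ⟩
  𝟙 b′ - 𝟙 b
    ∎
  where
  open ≡-Reasoning
  a : Bool
  a = satisfies w (ℓ , false) x
  signed : ∀ b → flagSign b * 𝟙 (satisfies w (ℓ , b) x) ≡ 𝟙 a - 𝟙 b
  signed b = trans (cong (λ s → flagSign b * 𝟙 s) (satisfies-xor w ℓ x b)) (signed-𝟙-xor a b)
  cancel : ∀ p q r → (p - q) - (p - r) ≡ r - q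
  cancel = solve-∀ ℤ-ring

signedIndicator : ∀ {m d} → (Fin m → Vecℚ d) → Vecℚ d → (Fin m → Bool) → Vecℚ d → ℤ
signedIndicator n v s x = sgn (count s) * 𝟙 (x ∈C facetCone n v (just ∘ s))

signedIndicator-suc : ∀ {m d} (n : Fin (suc m) → Vecℚ d) v s x →
  signedIndicator n v s x
    ≡ flagSign (s zero) * 𝟙 (satisfies v (n zero , s zero) x) * signedIndicator (n ∘ suc) v (s ∘ suc) x
signedIndicator-suc n v s x = begin
  sgn (count s) * 𝟙 (x ∈C facetCone n v (just ∘ s))
    ≡⟨ cong₂ _*_ (sgn-count-suc s) (trans (cong 𝟙 (facetCone-∈-suc n v (just ∘ s) x)) (𝟙-∧ a m)) ⟩
  flagSign (s zero) * sgn (count (s ∘ suc)) * (𝟙 a * 𝟙 m)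
    ≡⟨ regroup (flagSign (s zero)) (sgn (count (s ∘ suc))) (𝟙 a) (𝟙 m) ⟩
  flagSign (s zero) * 𝟙 a * (sgn (count (s ∘ suc)) * 𝟙 m)
    ∎
  where
  open ≡-Reasoning
  a m : Bool
  a = satisfies v (n zero , s zero) x
  m = x ∈C facetCone (n ∘ suc) v (just ∘ s ∘ suc)
  regroup : ∀ σ S A M → σ * S * (A * M) ≡ σ * A * (S * M)
  regroup = solve-∀ ℤ-ring

prependFlag : ∀ {m} → Bool → ℤ × (Fin m → Maybe Bool) → ℤ × (Fin (suc m) → Maybe Bool)
prependFlag b (z , c) = flagSign b * z , just b ∷ᵥ c

telescope : ∀ {m} → (Fin m → Bool) → (Fin m → Bool) → List (ℤ × (Fin m → Maybe Bool))
telescope {zero}  s t = []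
telescope {suc m} s t =
  ((𝟙 (t zero) - 𝟙 (s zero)) * sgn (count (t ∘ suc)) , nothing ∷ᵥ just ∘ t ∘ suc)
  ∷ map (prependFlag (s zero)) (telescope (s ∘ suc) (t ∘ suc))

telescope-dropsFacet : ∀ {m} (s t : Fin m → Bool) → All DropsFacet (telescope s t)
telescope-dropsFacet {zero}  s t = []
telescope-dropsFacet {suc m} s t =
  (zero , refl) ∷ map⁺ (All.map (λ (i , cᵢ≡nothing) → suc i , cᵢ≡nothing) (telescope-dropsFacet (s ∘ suc) (t ∘ suc)))

combo-prepend : ∀ {m d} (n : Fin (suc m) → Vecℚ d) v b L x →
  combo (facetCombo n v (map (prependFlag b) L)) x
    ≡ flagSign b * 𝟙 (satisfies v (n zero , b) x) * combo (facetCombo (n ∘ suc) v L) x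
combo-prepend n v b []            x = sym (ℤ.*-zeroʳ (flagSign b * 𝟙 (satisfies v (n zero , b) x)))
combo-prepend n v b ((z , c) ∷ L) x = begin
  flagSign b * z * 𝟙 (x ∈C facetCone n v (just b ∷ᵥ c)) + combo (facetCombo n v (map (prependFlag b) L)) x
    ≡⟨ cong₂ _+_ (cong (flagSign b * z *_) (trans (cong 𝟙 (facetCone-∈-suc n v (just b ∷ᵥ c) x)) (𝟙-∧ a m)))
                 (combo-prepend n v b L x) ⟩
  flagSign b * z * (𝟙 a * 𝟙 m) + flagSign b * 𝟙 a * R
    ≡⟨ factor (flagSign b) z (𝟙 a) (𝟙 m) R ⟩
  flagSign b * 𝟙 a * (z * 𝟙 m + R)
    ∎
  where
  open ≡-Reasoning
  a m : Bool
  a = satisfies v (n zero , b) x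
  m = x ∈C facetCone (n ∘ suc) v c
  R : ℤ
  R = combo (facetCombo (n ∘ suc) v L) x
  factor : ∀ σ z A M R → σ * z * (A * M) + σ * A * R ≡ σ * A * (z * M + R)
  factor = solve-∀ ℤ-ring

telescope-sound : ∀ {m d} (n : Fin m → Vecℚ d) v s t x →
  signedIndicator n v s x - signedIndicator n v t x ≡ combo (facetCombo n v (telescope s t)) x
telescope-sound {zero}  n v s t x = refl
telescope-sound {suc m} n v s t x = begin
  signedIndicator n v s x - signedIndicator n v t x
    ≡⟨ cong₂ _-_ (signedIndicator-suc n v s x) (signedIndicator-suc n v t x) ⟩
  σA * Φs - σB * Φt
    ≡⟨ split σA σB Φs Φt ⟩
  (σA - σB) * Φt + σA * (Φs - Φt)
    ≡⟨ cong₂ _+_ (cong (_* Φt) (signed-difference v (n zero) x (s zero) (t zero)))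
                 (cong (σA *_) (telescope-sound (n ∘ suc) v (s ∘ suc) (t ∘ suc) x)) ⟩
  (𝟙 (t zero) - 𝟙 (s zero)) * Φt + σA * combo (facetCombo (n ∘ suc) v (telescope (s ∘ suc) (t ∘ suc))) x
    ≡⟨ cong₂ _+_ droppedFacet (sym (combo-prepend n v (s zero) (telescope (s ∘ suc) (t ∘ suc)) x)) ⟩
  combo (facetCombo n v (telescope s t)) x
    ∎
  where
  open ≡-Reasoning
  σA σB Φs Φt : ℤ
  σA = flagSign (s zero) * 𝟙 (satisfies v (n zero , s zero) x)
  σB = flagSign (t zero) * 𝟙 (satisfies v (n zero , t zero) x)
  Φs = signedIndicator (n ∘ suc) v (s ∘ suc) x
  Φt = signedIndicator (n ∘ suc) v (t ∘ suc) x
  split : ∀ a b p q → a * p - b * q ≡ (a - b) * q + a * (p - q)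
  split = solve-∀ ℤ-ring
  droppedFacet : (𝟙 (t zero) - 𝟙 (s zero)) * Φt
    ≡ (𝟙 (t zero) - 𝟙 (s zero)) * sgn (count (t ∘ suc)) * 𝟙 (x ∈C facetCone n v (nothing ∷ᵥ just ∘ t ∘ suc))
  droppedFacet = begin
    (𝟙 (t zero) - 𝟙 (s zero)) * (sgn (count (t ∘ suc)) * 𝟙 (x ∈C facetCone (n ∘ suc) v (just ∘ t ∘ suc)))
      ≡⟨ ℤ.*-assoc (𝟙 (t zero) - 𝟙 (s zero)) _ _ ⟨
    (𝟙 (t zero) - 𝟙 (s zero)) * sgn (count (t ∘ suc)) * 𝟙 (x ∈C facetCone (n ∘ suc) v (just ∘ t ∘ suc))
      ≡⟨ cong (λ b → (𝟙 (t zero) - 𝟙 (s zero)) * sgn (count (t ∘ suc)) * 𝟙 (b ∧ x ∈C facetCone (n ∘ suc) v (just ∘ t ∘ suc)))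
              (trivial-satisfied v x) ⟨
    (𝟙 (t zero) - 𝟙 (s zero)) * sgn (count (t ∘ suc)) * 𝟙 (satisfies v (0ᵥ , false) x ∧ x ∈C facetCone (n ∘ suc) v (just ∘ t ∘ suc))
      ≡⟨ cong (λ b → (𝟙 (t zero) - 𝟙 (s zero)) * sgn (count (t ∘ suc)) * 𝟙 b) (facetCone-∈-suc n v (nothing ∷ᵥ just ∘ t ∘ suc) x) ⟨
    (𝟙 (t zero) - 𝟙 (s zero)) * sgn (count (t ∘ suc)) * 𝟙 (x ∈C facetCone n v (nothing ∷ᵥ just ∘ t ∘ suc))
      ∎

-- polCone n v α is facetCone n v (just ∘ polarFlags α) by definition.
polarFlags : ∀ {d} → (Fin d → ℚ) → Fin d → Bool
polarFlags α i = does (α i <? 0ℚ)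

flagCoefficient : Bool → ℚ
flagCoefficient true  = -ℚ 1ℚ
flagCoefficient false = 1ℚ

flagCoefficient-polarFlag : ∀ b → does (flagCoefficient b <? 0ℚ) ≡ b
flagCoefficient-polarFlag true  = refl
flagCoefficient-polarFlag false = refl

flagCoefficient-nonzero : ∀ b → ¬ flagCoefficient b ≡ 0ℚ
flagCoefficient-nonzero true  ()
flagCoefficient-nonzero false ()

polCone-covering : ∀ {d} (n : Fin d → Vecℚ d) v x → ∃[ α ] (Admissible α × x ∈C polCone n v α ≡ true)
polCone-covering n v x = α , flagCoefficient-nonzero ∘ flag , facetCone-∈⁺ {c = just ∘ polarFlags α} ownFlag
  where
  flag : Fin _ → Bool
  flag j = satisfies v (n j , true) x
  α : Fin _ → ℚ
  α = flagCoefficient ∘ flag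
  ownFlag : ∀ j → satisfies v (n j , polarFlags α j) x ≡ true
  ownFlag j rewrite flagCoefficient-polarFlag (flag j) = satisfies-ownFlag v (n j) x

polCone-unique : ∀ {d} (n : Fin d → Vecℚ d) v α β {x} →
  x ∈C polCone n v α ≡ true → x ∈C polCone n v β ≡ true → polCone n v α ≡ polCone n v β
polCone-unique {d} n v α β {x} x∈α x∈β = cong (mkCone v) (map-cong (λ j → cong (n j ,_) (sameFlag j)) (listFin d))
  where
  polarFlag≡strict : ∀ γ → x ∈C polCone n v γ ≡ true → ∀ j → polarFlags γ j ≡ satisfies v (n j , true) x
  polarFlag≡strict γ x∈γ j = satisfies⇒flag v (n j) x (polarFlags γ j) (facetCone-∈⁻ {c = just ∘ polarFlags γ} x∈γ j)
  sameFlag : ∀ j → polarFlags α j ≡ polarFlags β j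
  sameFlag j = trans (polarFlag≡strict α x∈α j) (sym (polarFlag≡strict β x∈β j))

lemma2p1 : (d : ℕ) (n : Fin d → Vecℚ d) (v : Vecℚ d) → LinIndep n →
    -- (1) the polarized tangent cones partition ℚ^d
    ( (∀ (α : Fin d → ℚ) → Admissible α → ∃[ x ] (x ∈C polCone n v α ≡ true))
    × (∀ (x : Vecℚ d) → ∃[ α ] (Admissible α × (x ∈C polCone n v α ≡ true)))
    × (∀ (α β : Fin d → ℚ) (x : Vecℚ d) → Admissible α → Admissible β →
         x ∈C polCone n v α ≡ true → x ∈C polCone n v β ≡ true →
         ∀ (y : Vecℚ d) → y ∈C polCone n v α ≡ y ∈C polCone n v β) )
    ×
    -- (2) differences of signed indicators are ℤ-combinations of cones containing lines
    (∀ (α β : Fin d → ℚ) → Admissible α → Admissible β →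
       ∃[ L ] (All (λ cC → ContainsLine (proj₂ cC)) L
         × (∀ (x : Vecℚ d) →
              (sgn (ind α) * 𝟙 (x ∈C polCone n v α)) - (sgn (ind β) * 𝟙 (x ∈C polCone n v β))
                ≡ combo L x)))
lemma2p1 d n v indep =
  ( (λ α _ → facetCone-nonempty indep v (just ∘ polarFlags α))
  , polCone-covering n v
  , (λ α β x _ _ x∈α x∈β y → cong (y ∈C_) (polCone-unique n v α β x∈α x∈β)) )
  , λ α β _ _ →
      let L = telescope (polarFlags α) (polarFlags β) in
      facetCombo n v L
    , facetCombo-containsLines indep v L (telescope-dropsFacet (polarFlags α) (polarFlags β))
    , telescope-sound n v (polarFlags α) (polarFlags β)
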